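{- Let $l \geq 1$ and let $A_l = \{\varepsilon_i - \varepsilon_j \mid 1 \leq i \neq j \leq l+1\} \subset \mathbb{R}^{l+1}$ be the root system of type $A_l$, where $\varepsilon_1,\dots,\varepsilon_{l+1}$ is the standard basis of $\mathbb{R}^{l+1}$. There exists a subset $H \subset A_l$ containing exactly one vector from each antipodal pair $\{\alpha,-\alpha\}$ of $A_l$ such that $\sum_{\alpha\in H}\alpha = \mathbf{0}$ if and only if $l \equiv 0 \pmod 2$.
   Context: A "half" of an antipodal set of vectors means a subset containing exactly one vector from each antipodal pair $\{\alpha,-\alpha\}$. -}

module Defs where

open import Data.Bool using (Bool; true; false)
open import Data.Nat using (ℕ; suc)
open import Data.Fin using (Fin; _≟_)
open import Data.Integer using (ℤ; _+_; _-_; 0ℤ; 1ℤ)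
open import Data.List using (List; []; _∷_; map; filter; allFin; cartesianProduct)
open import Data.Product using (_×_; _,_; proj₁; proj₂)
open import Data.Sum using (_⊎_)
open import Relation.Binary.PropositionalEquality using (_≡_; _≢_)
open import Relation.Nullary using (yes; no; ¬?)
open import Relation.Nullary.Decidable using (_×-dec_)
open import Data.Bool.Properties using () renaming (_≟_ to _≟ᵇ_)

-- vectors of ℝⁿ with integer coordinates (all roots of A_l lie in ℤ^{l+1})
Vect : ℕ → Set
Vect n = Fin n → ℤ

ε : ∀ {n} → Fin n → Vect n
ε i k with k ≟ i
... | yes _ = 1ℤ
... | no  _ = 0ℤ

root : ∀ {n} → Fin n → Fin n → Vect n
root i j k = ε i k - ε j k

zeroV : ∀ {n} → Vect n
zeroV _ = 0ℤ

_⊕_ : ∀ {n} → Vect n → Vect n → Vect n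
(u ⊕ v) k = u k + v k

vsum : ∀ {n} → List (Vect n) → Vect n
vsum []       = zeroV
vsum (v ∷ vs) = v ⊕ vsum vs

-- A subset of A_l (with n = l+1) is given by its membership predicate on
-- roots, indexed by ordered pairs (i , j), i ≢ j, representing ε_i - ε_j
-- (this indexing is a bijection onto A_l). Diagonal values are ignored.
RootSubset : ℕ → Set
RootSubset n = Fin n → Fin n → Bool

IsHalf : ∀ {n} → RootSubset n → Set
IsHalf H = ∀ i j → i ≢ j →
  (H i j ≡ true × H j i ≡ false) ⊎ (H i j ≡ false × H j i ≡ true)

memberPairs : ∀ {n} → RootSubset n → List (Fin n × Fin n)
memberPairs {n} H =
  filter (λ p → ¬? (proj₁ p ≟ proj₂ p) ×-dec (H (proj₁ p) (proj₂ p) ≟ᵇ true))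
         (cartesianProduct (allFin n) (allFin n))

sumRoots : ∀ {n} → RootSubset n → Vect n
sumRoots H = vsum (map (λ p → root (proj₁ p) (proj₂ p)) (memberPairs H))

-- A half of A_l is a tournament on the l + 1 indices (ε_i − ε_j ∈ H meaning that i beats j),
-- and the k-th coordinate of the sum of its roots is outdegree(k) − indegree(k). As
-- outdegree(k) + indegree(k) = l, a zero sum forces l = 2 · outdegree(k). Conversely, for l
-- even the tournament in which i < j beats j exactly when j − i is odd is regular: the
-- flow along row k alternates in sign and sums to (r mod 2) − (k mod 2), where k + r = l.

module Submission where

open import Defs
open import Data.Bool using (Bool; true; false; not; if_then_else_)
open import Data.Bool.Properties using (not-involutive) renaming (_≟_ to _≟ᵇ_)
open import Data.Fin using (Fin; zero; suc; toℕ; _≟_; punchIn)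
open import Data.Fin.Properties using (toℕ-injective; toℕ≤pred[n]; punchInᵢ≢i)
open import Data.Integer using (ℤ; +_; _+_; _-_; _*_; -_; 0ℤ; 1ℤ; -1ℤ; ∣_∣)
import Data.Integer.Properties as ℤ
open import Data.Integer.Tactic.RingSolver using (solve-∀)
open import Data.List using (List; []; _∷_; _++_; map; filter; tabulate; allFin; cartesianProduct)
open import Data.List.Properties using (map-++; map-∘)
open import Data.Nat as ℕ using (ℕ; zero; suc; _≤_; _%_; _≡ᵇ_)
open import Data.Nat.Divisibility using (n∣m⇒m%n≡0; divides)
import Data.Nat.Properties as ℕ
open import Data.Product using (Σ; _×_; _,_; proj₁; proj₂)
open import Data.Sum using (_⊎_; inj₁; inj₂)
open import Function.Base using (_∘_; id)
open import Function.Bundles using (_⇔_; mk⇔)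
open import Relation.Binary.PropositionalEquality
open import Relation.Nullary using (yes; no; does; ¬?; contradiction)
open import Relation.Nullary.Decidable using (_×-dec_)
open import Relation.Unary using (Pred; Decidable)
open import Algebra.Properties.Semiring.Sum ℤ.+-*-semiring
  using (sum; sum-syntax; sum-cong-≗; sum-remove; sum-replicate-zero; ∑-distrib-+; *-distribˡ-sum; *-distribʳ-sum)

open ≡-Reasoning

∑-neg : ∀ {n} (f : Fin n → ℤ) → ∑[ i < n ] (- f i) ≡ - (∑[ i < n ] f i)
∑-neg f = begin
  ∑[ i < _ ] (- f i)      ≡⟨ sum-cong-≗ (λ i → sym (ℤ.-1*i≡-i (f i))) ⟩
  ∑[ i < _ ] (-1ℤ * f i)  ≡⟨ *-distribˡ-sum -1ℤ f ⟨
  -1ℤ * (∑[ i < _ ] f i)  ≡⟨ ℤ.-1*i≡-i _ ⟩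
  - (∑[ i < _ ] f i)      ∎

∑-distrib-minus : ∀ {n} (f g : Fin n → ℤ) → ∑[ i < n ] (f i - g i) ≡ (∑[ i < n ] f i) - (∑[ i < n ] g i)
∑-distrib-minus f g = trans (∑-distrib-+ f (-_ ∘ g)) (cong (_+_ (sum f)) (∑-neg g))

∑-const-1 : ∀ n → ∑[ _ < n ] 1ℤ ≡ + n
∑-const-1 zero    = refl
∑-const-1 (suc n) = cong (_+_ 1ℤ) (∑-const-1 n)

ε-diag : ∀ {n} (i : Fin n) → ε i i ≡ 1ℤ
ε-diag i with i ≟ i
... | yes _   = refl
... | no  i≢i = contradiction refl i≢i

ε-off : ∀ {n} {i k : Fin n} → k ≢ i → ε i k ≡ 0ℤ
ε-off {i = i} {k} k≢i with k ≟ i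
... | yes k≡i = contradiction k≡i k≢i
... | no  _   = refl

∑-δ : ∀ {n} (f : Fin n → ℤ) (k : Fin n) → ∑[ i < n ] (f i * ε i k) ≡ f k
∑-δ {suc n} f k = begin
  sum t                                     ≡⟨ sum-remove {i = k} t ⟩
  t k + ∑[ i < n ] t (punchIn k i)          ≡⟨ cong₂ _+_ (cong (f k *_) (ε-diag k)) (sum-cong-≗ vanishes) ⟩
  f k * 1ℤ + ∑[ _ < n ] 0ℤ                  ≡⟨ cong₂ _+_ (ℤ.*-identityʳ (f k)) (sum-replicate-zero n) ⟩
  f k + 0ℤ                                  ≡⟨ ℤ.+-identityʳ (f k) ⟩
  f k                                       ∎
  where
  t : Fin (suc n) → ℤ
  t i = f i * ε i k
  vanishes : ∀ i → t (punchIn k i) ≡ 0ℤ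
  vanishes i = trans (cong (f (punchIn k i) *_) (ε-off (punchInᵢ≢i k i ∘ sym))) (ℤ.*-zeroʳ (f (punchIn k i)))

∑-ε : ∀ {n} (k : Fin n) → ∑[ j < n ] ε j k ≡ 1ℤ
∑-ε k = trans (sum-cong-≗ (λ j → sym (ℤ.*-identityˡ (ε j k)))) (∑-δ (λ _ → 1ℤ) k)

vsum-++ : ∀ {n} (us vs : List (Vect n)) k → vsum (us ++ vs) k ≡ vsum us k + vsum vs k
vsum-++ []       vs k = sym (ℤ.+-identityˡ _)
vsum-++ (u ∷ us) vs k = trans (cong (_+_ (u k)) (vsum-++ us vs k)) (sym (ℤ.+-assoc (u k) _ _))

indicator : Bool → ℤ
indicator true  = 1ℤ
indicator false = 0ℤ

vsum-map-filter : ∀ {A : Set} {p n} {P : Pred A p} (P? : Decidable P) (g : A → Vect n) xs k →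
  vsum (map g (filter P? xs)) k ≡ vsum (map (λ x l → indicator (does (P? x)) * g x l) xs) k
vsum-map-filter P? g []       k = refl
vsum-map-filter P? g (x ∷ xs) k with does (P? x)
... | true  = cong₂ _+_ (sym (ℤ.*-identityˡ (g x k))) (vsum-map-filter P? g xs k)
... | false = trans (vsum-map-filter P? g xs k) (sym (ℤ.+-identityˡ _))

vsum-map-tabulate : ∀ {A : Set} {m n} (g : A → Vect n) (f : Fin m → A) k →
  vsum (map g (tabulate f)) k ≡ ∑[ i < m ] g (f i) k
vsum-map-tabulate {m = zero}  g f k = refl
vsum-map-tabulate {m = suc m} g f k = cong (_+_ (g (f zero) k)) (vsum-map-tabulate g (f ∘ suc) k)

vsum-map-cartesianProduct : ∀ {A B : Set} {m n} (g : A × B → Vect n) (f : Fin m → A) ys k →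
  vsum (map g (cartesianProduct (tabulate f) ys)) k ≡ ∑[ i < m ] vsum (map (λ y → g (f i , y)) ys) k
vsum-map-cartesianProduct {m = zero}  g f ys k = refl
vsum-map-cartesianProduct {m = suc m} g f ys k = begin
  vsum (map g (map (f zero ,_) ys ++ rest)) k
    ≡⟨ cong (λ vs → vsum vs k) (map-++ g (map (f zero ,_) ys) rest) ⟩
  vsum (map g (map (f zero ,_) ys) ++ map g rest) k
    ≡⟨ vsum-++ (map g (map (f zero ,_) ys)) (map g rest) k ⟩
  vsum (map g (map (f zero ,_) ys)) k + vsum (map g rest) k
    ≡⟨ cong₂ _+_ (cong (λ vs → vsum vs k) (map-∘ ys)) (sym (vsum-map-cartesianProduct g (f ∘ suc) ys k)) ⟨
  ∑[ i < suc m ] vsum (map (λ y → g (f i , y)) ys) k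
    ∎
  where rest = cartesianProduct (tabulate (f ∘ suc)) ys

-- The predicate filtering memberPairs, so that memberPairs H ≡ filter (isMember? H) _ holds by refl.
isMember? : ∀ {n} (H : RootSubset n) → Decidable (λ (p : Fin n × Fin n) → proj₁ p ≢ proj₂ p × H (proj₁ p) (proj₂ p) ≡ true)
isMember? H (i , j) = ¬? (i ≟ j) ×-dec (H i j ≟ᵇ true)

edge : ∀ {n} → RootSubset n → Fin n → Fin n → ℤ
edge H i j = indicator (does (isMember? H (i , j)))

outdegree indegree : ∀ {n} → RootSubset n → Fin n → ℤ
outdegree {n} H k = ∑[ j < n ] edge H k j
indegree  {n} H k = ∑[ i < n ] edge H i k

sumRoots≡outdegree-indegree : ∀ {n} (H : RootSubset n) k → sumRoots H k ≡ outdegree H k - indegree H k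
sumRoots≡outdegree-indegree {n} H k = begin
  sumRoots H k
    ≡⟨ vsum-map-filter (isMember? H) (λ p → root (proj₁ p) (proj₂ p)) pairs k ⟩
  vsum (map (λ p l → edge H (proj₁ p) (proj₂ p) * root (proj₁ p) (proj₂ p) l) pairs) k
    ≡⟨ vsum-map-cartesianProduct (λ p l → edge H (proj₁ p) (proj₂ p) * root (proj₁ p) (proj₂ p) l) id (allFin n) k ⟩
  ∑[ i < n ] vsum (map (λ j l → edge H i j * root i j l) (allFin n)) k
    ≡⟨ sum-cong-≗ (λ i → vsum-map-tabulate (λ j l → edge H i j * root i j l) id k) ⟩
  ∑[ i < n ] ∑[ j < n ] (edge H i j * root i j k)
    ≡⟨ sum-cong-≗ split ⟩
  ∑[ i < n ] ((∑[ j < n ] (edge H i j * ε i k)) - (∑[ j < n ] (edge H i j * ε j k)))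
    ≡⟨ ∑-distrib-minus (λ i → ∑[ j < n ] (edge H i j * ε i k)) (λ i → ∑[ j < n ] (edge H i j * ε j k)) ⟩
  (∑[ i < n ] ∑[ j < n ] (edge H i j * ε i k)) - (∑[ i < n ] ∑[ j < n ] (edge H i j * ε j k))
    ≡⟨ cong₂ _-_ (trans (sum-cong-≗ (λ i → sym (*-distribʳ-sum (ε i k) (edge H i)))) (∑-δ (outdegree H) k))
                 (sum-cong-≗ (λ i → ∑-δ (edge H i) k)) ⟩
  outdegree H k - indegree H k ∎
  where
  pairs = cartesianProduct (allFin n) (allFin n)
  *-distribˡ-minus : ∀ a b c → a * (b - c) ≡ a * b - a * c
  *-distribˡ-minus = solve-∀
  split : ∀ i → ∑[ j < n ] (edge H i j * root i j k) ≡ (∑[ j < n ] (edge H i j * ε i k)) - (∑[ j < n ] (edge H i j * ε j k))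
  split i = trans (sum-cong-≗ (λ j → *-distribˡ-minus (edge H i j) (ε i k) (ε j k)))
                  (∑-distrib-minus (λ j → edge H i j * ε i k) (λ j → edge H i j * ε j k))

edge-diag : ∀ {n} (H : RootSubset n) i → edge H i i ≡ 0ℤ
edge-diag H i with i ≟ i
... | yes _   = refl
... | no  i≢i = contradiction refl i≢i

edge-off : ∀ {n} (H : RootSubset n) {i j} → i ≢ j → edge H i j ≡ indicator (H i j)
edge-off H {i} {j} i≢j with i ≟ j | H i j
... | yes i≡j | _     = contradiction i≡j i≢j
... | no  _   | true  = refl
... | no  _   | false = refl

diag-or-off : ∀ {n} {P : Fin n → Fin n → Set} → (∀ k → P k k) → (∀ {k j} → k ≢ j → P k j) → ∀ k j → P k j
diag-or-off diag off k j with k ≟ j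
... | yes refl = diag k
... | no  k≢j  = off k≢j

sign : Bool → ℤ
sign true  = 1ℤ
sign false = -1ℤ

Opposite : Bool → Bool → Set
Opposite b c = (b ≡ true × c ≡ false) ⊎ (b ≡ false × c ≡ true)

indicator-opposite-plus : ∀ {b c} → Opposite b c → indicator b + indicator c ≡ 1ℤ
indicator-opposite-plus (inj₁ (refl , refl)) = refl
indicator-opposite-plus (inj₂ (refl , refl)) = refl

indicator-opposite-minus : ∀ {b c} → Opposite b c → indicator b - indicator c ≡ sign b
indicator-opposite-minus (inj₁ (refl , refl)) = refl
indicator-opposite-minus (inj₂ (refl , refl)) = refl

module _ {n} {H : RootSubset n} (half : IsHalf H) where

  edge-plus-reversed : ∀ k j → edge H k j + edge H j k ≡ 1ℤ - ε j k
  edge-plus-reversed = diag-or-off diag off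
    where
    diag : ∀ k → edge H k k + edge H k k ≡ 1ℤ - ε k k
    diag k = begin
      edge H k k + edge H k k  ≡⟨ cong₂ _+_ (edge-diag H k) (edge-diag H k) ⟩
      0ℤ                       ≡⟨ cong (_-_ 1ℤ) (ε-diag k) ⟨
      1ℤ - ε k k               ∎
    off : ∀ {k j} → k ≢ j → edge H k j + edge H j k ≡ 1ℤ - ε j k
    off {k} {j} k≢j = begin
      edge H k j + edge H j k               ≡⟨ cong₂ _+_ (edge-off H k≢j) (edge-off H (k≢j ∘ sym)) ⟩
      indicator (H k j) + indicator (H j k) ≡⟨ indicator-opposite-plus (half k j k≢j) ⟩
      1ℤ                                    ≡⟨ cong (_-_ 1ℤ) (ε-off k≢j) ⟨
      1ℤ - ε j k                            ∎

  edge-minus-reversed : ∀ {k j} → k ≢ j → edge H k j - edge H j k ≡ sign (H k j)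
  edge-minus-reversed {k} {j} k≢j = begin
    edge H k j - edge H j k               ≡⟨ cong₂ _-_ (edge-off H k≢j) (edge-off H (k≢j ∘ sym)) ⟩
    indicator (H k j) - indicator (H j k) ≡⟨ indicator-opposite-minus (half k j k≢j) ⟩
    sign (H k j)                          ∎

  outdegree+indegree : ∀ k → outdegree H k + indegree H k ≡ + n - 1ℤ
  outdegree+indegree k = begin
    outdegree H k + indegree H k          ≡⟨ ∑-distrib-+ (edge H k) (λ j → edge H j k) ⟨
    ∑[ j < n ] (edge H k j + edge H j k)  ≡⟨ sum-cong-≗ (edge-plus-reversed k) ⟩
    ∑[ j < n ] (1ℤ - ε j k)               ≡⟨ ∑-distrib-minus (λ _ → 1ℤ) (λ j → ε j k) ⟩
    (∑[ j < n ] 1ℤ) - (∑[ j < n ] ε j k)  ≡⟨ cong₂ _-_ (∑-const-1 n) (∑-ε k) ⟩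
    + n - 1ℤ                              ∎

+m≡i+i⇒m%2≡0 : ∀ {m} (i : ℤ) → + m ≡ i + i → m % 2 ≡ 0
+m≡i+i⇒m%2≡0 {m} i m≡i+i = n∣m⇒m%n≡0 m 2 (divides ∣ i ∣ (begin
  m               ≡⟨ cong ∣_∣ (trans m≡i+i (i+i≡2*i i)) ⟩
  ∣ + 2 * i ∣     ≡⟨ ℤ.abs-* (+ 2) i ⟩
  2 ℕ.* ∣ i ∣     ≡⟨ ℕ.*-comm 2 ∣ i ∣ ⟩
  ∣ i ∣ ℕ.* 2     ∎))
  where
  i+i≡2*i : ∀ i → i + i ≡ + 2 * i
  i+i≡2*i = solve-∀

half-balanced⇒even : ∀ {l} {H : RootSubset (suc l)} → IsHalf H → (∀ k → sumRoots H k ≡ 0ℤ) → l % 2 ≡ 0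
half-balanced⇒even {l} {H} half balanced = +m≡i+i⇒m%2≡0 (outdegree H zero) (begin
  + l                                     ≡⟨ outdegree+indegree half zero ⟨
  outdegree H zero + indegree H zero      ≡⟨ cong (_+_ (outdegree H zero)) out≡in ⟨
  outdegree H zero + outdegree H zero     ∎)
  where
  out≡in : outdegree H zero ≡ indegree H zero
  out≡in = ℤ.i-j≡0⇒i≡j _ _ (trans (sym (sumRoots≡outdegree-indegree H zero)) (balanced zero))

isOdd : ℕ → Bool
isOdd n = n % 2 ≡ᵇ 1

-- For i < j: i beats j iff j − i is odd.
beats : ℕ → ℕ → Bool
beats zero    zero    = false
beats zero    (suc j) = isOdd (suc j)
beats (suc i) zero    = not (isOdd (suc i))
beats (suc i) (suc j) = beats i j

beats-antisym : ∀ {a b} → a ≢ b → beats b a ≡ not (beats a b)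
beats-antisym {zero}  {zero}  a≢b = contradiction refl a≢b
beats-antisym {zero}  {suc b} a≢b = refl
beats-antisym {suc a} {zero}  a≢b = sym (not-involutive _)
beats-antisym {suc a} {suc b} a≢b = beats-antisym (a≢b ∘ cong suc)

tournament : ∀ n → RootSubset n
tournament n i j = beats (toℕ i) (toℕ j)

opposite-not : ∀ b {c} → c ≡ not b → Opposite b c
opposite-not true  refl = inj₁ (refl , refl)
opposite-not false refl = inj₂ (refl , refl)

tournament-isHalf : ∀ n → IsHalf (tournament n)
tournament-isHalf n i j i≢j = opposite-not _ (beats-antisym (i≢j ∘ toℕ-injective))

tournamentFlow : ℕ → ℕ → ℤ
tournamentFlow a b = if a ≡ᵇ b then 0ℤ else sign (beats a b)

tournamentFlow-diag : ∀ a → tournamentFlow a a ≡ 0ℤ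
tournamentFlow-diag zero    = refl
tournamentFlow-diag (suc a) = tournamentFlow-diag a

tournamentFlow-off : ∀ {a b} → a ≢ b → tournamentFlow a b ≡ sign (beats a b)
tournamentFlow-off {zero}  {zero}  a≢b = contradiction refl a≢b
tournamentFlow-off {zero}  {suc b} a≢b = refl
tournamentFlow-off {suc a} {zero}  a≢b = refl
tournamentFlow-off {suc a} {suc b} a≢b = tournamentFlow-off (a≢b ∘ cong suc)

tournament-edge-minus-reversed : ∀ n (k j : Fin n) →
  edge (tournament n) k j - edge (tournament n) j k ≡ tournamentFlow (toℕ k) (toℕ j)
tournament-edge-minus-reversed n = diag-or-off diag off
  where
  T = tournament n
  diag : ∀ k → edge T k k - edge T k k ≡ tournamentFlow (toℕ k) (toℕ k)
  diag k = trans (cong₂ _-_ (edge-diag T k) (edge-diag T k)) (sym (tournamentFlow-diag (toℕ k)))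
  off : ∀ {k j} → k ≢ j → edge T k j - edge T j k ≡ tournamentFlow (toℕ k) (toℕ j)
  off k≢j = trans (edge-minus-reversed (tournament-isHalf n) k≢j) (sym (tournamentFlow-off (k≢j ∘ toℕ-injective)))

tournamentFlow-row₀ : ∀ r → ∑[ j < r ] tournamentFlow 0 (suc (toℕ j)) ≡ + (r % 2)
tournamentFlow-row₀ zero          = refl
tournamentFlow-row₀ (suc zero)    = refl
tournamentFlow-row₀ (suc (suc r)) = trans (cong (λ x → 1ℤ + (-1ℤ + x)) (tournamentFlow-row₀ r)) (cancel _)
  where
  cancel : ∀ x → 1ℤ + (-1ℤ + x) ≡ x
  cancel = solve-∀

sign-not-isOdd : ∀ k → sign (not (isOdd (suc k))) ≡ + (k % 2) - + (suc k % 2)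
sign-not-isOdd zero          = refl
sign-not-isOdd (suc zero)    = refl
sign-not-isOdd (suc (suc k)) = sign-not-isOdd k

tournamentFlow-row : ∀ k r → ∑[ j < suc (k ℕ.+ r) ] tournamentFlow k (toℕ j) ≡ + (r % 2) - + (k % 2)
tournamentFlow-row zero r = begin
  0ℤ + ∑[ j < r ] tournamentFlow 0 (suc (toℕ j)) ≡⟨ ℤ.+-identityˡ _ ⟩
  ∑[ j < r ] tournamentFlow 0 (suc (toℕ j))      ≡⟨ tournamentFlow-row₀ r ⟩
  + (r % 2)                                      ≡⟨ ℤ.+-identityʳ _ ⟨
  + (r % 2) - + 0                                ∎
tournamentFlow-row (suc k) r = begin
  sign (not (isOdd (suc k))) + ∑[ j < suc (k ℕ.+ r) ] tournamentFlow k (toℕ j)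
    ≡⟨ cong₂ _+_ (sign-not-isOdd k) (tournamentFlow-row k r) ⟩
  (+ (k % 2) - + (suc k % 2)) + (+ (r % 2) - + (k % 2))
    ≡⟨ telescope (+ (k % 2)) (+ (suc k % 2)) (+ (r % 2)) ⟩
  + (r % 2) - + (suc k % 2) ∎
  where
  telescope : ∀ a b c → (a - b) + (c - a) ≡ c - b
  telescope = solve-∀

[m+n]%2≡0⇒m%2≡n%2 : ∀ m n → (m ℕ.+ n) % 2 ≡ 0 → m % 2 ≡ n % 2
[m+n]%2≡0⇒m%2≡n%2 zero          n eq = sym eq
[m+n]%2≡0⇒m%2≡n%2 (suc zero)    n eq = [1+n]%2≡0⇒n%2≡1 n eq
  where
  [1+n]%2≡0⇒n%2≡1 : ∀ n → suc n % 2 ≡ 0 → 1 ≡ n % 2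
  [1+n]%2≡0⇒n%2≡1 (suc zero)    eq = refl
  [1+n]%2≡0⇒n%2≡1 (suc (suc n)) eq = [1+n]%2≡0⇒n%2≡1 n eq
[m+n]%2≡0⇒m%2≡n%2 (suc (suc m)) n eq = [m+n]%2≡0⇒m%2≡n%2 m n eq

tournament-balanced : ∀ {l} → l % 2 ≡ 0 → ∀ k → sumRoots (tournament (suc l)) k ≡ 0ℤ
tournament-balanced {l} even k = begin
  sumRoots T k                                              ≡⟨ sumRoots≡outdegree-indegree T k ⟩
  outdegree T k - indegree T k                              ≡⟨ ∑-distrib-minus (edge T k) (λ j → edge T j k) ⟨
  ∑[ j < suc l ] (edge T k j - edge T j k)                  ≡⟨ sum-cong-≗ (tournament-edge-minus-reversed (suc l) k) ⟩
  ∑[ j < suc l ] tournamentFlow (toℕ k) (toℕ j)             ≡⟨ cong (λ m → ∑[ j < suc m ] tournamentFlow (toℕ k) (toℕ j)) k+r≡l ⟨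
  ∑[ j < suc (toℕ k ℕ.+ r) ] tournamentFlow (toℕ k) (toℕ j) ≡⟨ tournamentFlow-row (toℕ k) r ⟩
  + (r % 2) - + (toℕ k % 2)                                 ≡⟨ cong (λ x → + (r % 2) - + x) same-parity ⟩
  + (r % 2) - + (r % 2)                                     ≡⟨ ℤ.+-inverseʳ (+ (r % 2)) ⟩
  0ℤ                                                        ∎
  where
  T = tournament (suc l)
  r = l ℕ.∸ toℕ k
  k+r≡l : toℕ k ℕ.+ r ≡ l
  k+r≡l = ℕ.m+[n∸m]≡n (toℕ≤pred[n] k)
  same-parity : toℕ k % 2 ≡ r % 2
  same-parity = [m+n]%2≡0⇒m%2≡n%2 (toℕ k) r (subst (λ m → m % 2 ≡ 0) (sym k+r≡l) even)

proposition2p1 : (l : ℕ) → 1 ≤ l →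
    (Σ (RootSubset (suc l)) (λ H → IsHalf H × ((k : Fin (suc l)) → sumRoots H k ≡ 0ℤ)))
      ⇔ (l % 2 ≡ 0)
proposition2p1 l _ = mk⇔
  (λ (H , half , balanced) → half-balanced⇒even half balanced)
  (λ even → tournament (suc l) , tournament-isHalf (suc l) , tournament-balanced even)
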